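{- Let $p$ and $q$ be distinct positive integers and let $n \ge 2$. Then the grid graph $\square_n$ does not embed into the $(p,q)$-leaper graph $\mathcal{L}_n$.
   Context: Let $[n] = \{1, 2, \ldots, n\}$. The grid graph $\square_n$ has vertex set $[n]^2$, with $(x', y')$ and $(x'', y'')$ adjacent iff they are at Euclidean distance $1$. The $(p,q)$-leaper graph $\mathcal{L}_n$ has vertex set $[n]^2$, with $(x', y')$ and $(x'', y'')$ adjacent iff $\{|x' - x''|, |y' - y''|\} = \{p, q\}$. A graph $G$ embeds into a graph $H$ if $G$ is isomorphic to a (not necessarily induced) subgraph of $H$. -}

module Defs where

open import Data.Nat using (ℕ; ∣_-_∣)
open import Data.Fin using (Fin; toℕ)
open import Data.Product using (_×_; _,_)
open import Data.Sum using (_⊎_)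
open import Relation.Binary.PropositionalEquality using (_≡_)
open import Function.Definitions using (Injective)

-- Vertex set [n]^2, represented 0-indexed as Fin n × Fin n.
Vertex : ℕ → Set
Vertex n = Fin n × Fin n

dx : ∀ {n} → Vertex n → Vertex n → ℕ
dx (x₁ , _) (x₂ , _) = ∣ toℕ x₁ - toℕ x₂ ∣

dy : ∀ {n} → Vertex n → Vertex n → ℕ
dy (_ , y₁) (_ , y₂) = ∣ toℕ y₁ - toℕ y₂ ∣

-- Grid graph: adjacent iff Euclidean distance 1, i.e. the pair of
-- coordinate differences is (1,0) or (0,1).
GridAdj : ∀ {n} → Vertex n → Vertex n → Set
GridAdj u v = (dx u v ≡ 1 × dy u v ≡ 0) ⊎ (dx u v ≡ 0 × dy u v ≡ 1)

-- (p,q)-leaper graph: adjacent iff {|dx|,|dy|} = {p,q} (as sets).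
-- For p ≠ q this is: (dx,dy) = (p,q) or (q,p).
LeaperAdj : ℕ → ℕ → ∀ {n} → Vertex n → Vertex n → Set
LeaperAdj p q u v = (dx u v ≡ p × dy u v ≡ q) ⊎ (dx u v ≡ q × dy u v ≡ p)

-- G embeds into H (same vertex type): an injective map on vertices
-- sending edges to edges (not necessarily induced).
Embeds : {V W : Set} → (V → V → Set) → (W → W → Set) → Set
Embeds {V} {W} G H =
  Data.Product.Σ (V → W) λ f → Injective _≡_ _≡_ f × (∀ u v → G u v → H (f u) (f v))
  where import Data.Product

-- An embedding f of the grid into the (p,q)-leaper graph is injective on a finite set,
-- hence a bijection, and it maps each unit square of the grid onto a 4-cycle of leaps.
-- For p ≠ q every such 4-cycle is a parallelogram: writing each leap as a linear form
-- in p and q, the two closing equations admit no positive solution p ≠ q unless some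
-- later leap undoes the first one.  So each coordinate of f is separable,
-- f(i,j) + f(0,0) = f(i,0) + f(0,j).  A corner of the board has at most two leaper
-- neighbours, so the grid preimages of the corners (0,0), (m,0) and (0,m) lie in the
-- boundary rows 0 and m.  By separability these three rows are, along the first
-- column, a common argmin of both coordinates of f, an argmax of the first and argmin
-- of the second, and an argmin of the first and argmax of the second.  Both
-- coordinates vary along the first column, so the three rows are pairwise distinct,
-- which two boundary rows cannot accommodate.
module Submission where

open import Defs
open import Data.Empty using (⊥-elim)
open import Data.Fin using (Fin; toℕ; fromℕ<)
open import Data.Fin.Properties
  using (any?; _≟_; <⇒notInjective; punchOut-injective; *↔×; toℕ-fromℕ<; toℕ-injective;
         toℕ≤pred[n])
open import Data.Nat
  using (ℕ; zero; suc; _≤_; _∸_; ∣_-_∣; z≤n; s≤s; _≤?_; NonZero; ≢-nonZero⁻¹)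
  renaming (_≟_ to _≟ℕ_)
open import Data.Nat.Properties
  using (≤-refl; ≤-trans; ≤-antisym; ≤-total; n≤1+n; n<1+n; 1+n≢n; <-trans; <⇒≢; ≤∧≢⇒<;
         m⊓n≤n; m≤n⇒m⊓n≡m; +-comm; +-cancelˡ-≡; +-cancelʳ-≡; +-cancelʳ-≤; +-monoˡ-≤;
         ∣-∣-comm; ∣n-n∣≡0; m≡n⇒∣m-n∣≡0; m≤n⇒∣m-n∣≡n∸m; m≤n⇒∣n-m∣≡n∸m; m+n∸n≡m;
         m∸[m∸n]≡n)
open import Data.Product using (_×_; _,_; proj₁; proj₂; Σ; ∃)
open import Data.Sum using (_⊎_; inj₁; inj₂; [_,_]′)
import Data.Sum as Sum
open import Function using (_∘_)
open import Function.Bundles using (_↔_; Inverse; Injection)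
open import Function.Definitions using (Injective)
open import Function.Properties.Inverse using (↔-sym; ↔⇒↣)
open import Relation.Binary.PropositionalEquality
  using (_≡_; _≢_; refl; sym; trans; cong; cong₂; subst; subst₂; ≢-sym; module ≡-Reasoning)
open import Relation.Nullary using (¬_; yes; no)

injective⇒surjective : ∀ {k} (g : Fin k → Fin k) → Injective _≡_ _≡_ g →
  ∀ y → ∃ λ x → g x ≡ y
injective⇒surjective {zero}  g _     ()
injective⇒surjective {suc k} g g-inj y with any? (λ x → g x ≟ y)
... | yes hit = hit
... | no miss =
  ⊥-elim (<⇒notInjective (n<1+n k) (g-inj ∘ punchOut-injective (y≢g _) (y≢g _)))
  where
  y≢g : ∀ x → y ≢ g x
  y≢g x y≡gx = miss (x , sym y≡gx)

↔Fin-injective⇒surjective : ∀ {A : Set} {k} → Fin k ↔ A →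
  (f : A → A) → Injective _≡_ _≡_ f → ∀ y → ∃ λ x → f x ≡ y
↔Fin-injective⇒surjective e f f-inj y =
  let x , gx≡y = injective⇒surjective (from ∘ f ∘ to) (to-injective ∘ f-inj ∘ from-injective) (from y)
  in to x , from-injective gx≡y
  where
  open Inverse e
  to-injective : Injective _≡_ _≡_ to
  to-injective = Injection.injective (↔⇒↣ e)
  from-injective : Injective _≡_ _≡_ from
  from-injective = Injection.injective (↔⇒↣ (↔-sym e))

data Axis : Set where
  horizontal vertical : Axis

coord : ∀ {n} → Axis → Vertex n → ℕ
coord horizontal (x , _) = toℕ x
coord vertical   (_ , y) = toℕ y

vertex-≡ : ∀ {n} {u v : Vertex n} → (∀ a → coord a u ≡ coord a v) → u ≡ v
vertex-≡ h = cong₂ _,_ (toℕ-injective (h horizontal)) (toℕ-injective (h vertical))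

coord≤ : ∀ {m} a (v : Vertex (suc m)) → coord a v ≤ m
coord≤ horizontal (x , _) = toℕ≤pred[n] x
coord≤ vertical   (_ , y) = toℕ≤pred[n] y

GridAdj-sym : ∀ {n} (u v : Vertex n) → GridAdj u v → GridAdj v u
GridAdj-sym u v = Sum.map swap swap
  where
  swap : ∀ {a b} → dx u v ≡ a × dy u v ≡ b → dx v u ≡ a × dy v u ≡ b
  swap (ex , ey) = trans (∣-∣-comm (coord horizontal v) (coord horizontal u)) ex
                 , trans (∣-∣-comm (coord vertical v) (coord vertical u)) ey

∣m-n∣≡k⇒m≢n : ∀ {m n} k .{{_ : NonZero k}} → ∣ m - n ∣ ≡ k → m ≢ n
∣m-n∣≡k⇒m≢n k d m≡n = ≢-nonZero⁻¹ k (trans (sym d) (m≡n⇒∣m-n∣≡0 m≡n))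

leaperAdj⇒coord≢ : ∀ {p q n} .{{_ : NonZero p}} .{{_ : NonZero q}} {u v : Vertex n} →
  LeaperAdj p q u v → ∀ a → coord a u ≢ coord a v
leaperAdj⇒coord≢ {p} {q} (inj₁ (ex , _)) horizontal = ∣m-n∣≡k⇒m≢n p ex
leaperAdj⇒coord≢ {p} {q} (inj₁ (_ , ey)) vertical   = ∣m-n∣≡k⇒m≢n q ey
leaperAdj⇒coord≢ {p} {q} (inj₂ (ex , _)) horizontal = ∣m-n∣≡k⇒m≢n q ex
leaperAdj⇒coord≢ {p} {q} (inj₂ (_ , ey)) vertical   = ∣m-n∣≡k⇒m≢n p ey

module LeaperCycles where

  open import Data.Bool using (Bool; true; false)
  import Data.Bool.Properties as Bool
  open import Data.Integer
    using (ℤ; +_; +[1+_]; -[1+_]; 0ℤ; 1ℤ; -1ℤ; _+_; _-_; _*_; -_; _⊖_; _<_; _<?_; -<+)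
    renaming (_≟_ to _≟ℤ_)
  open import Data.Integer.Properties
    using (+-identityˡ; +-identityʳ; *-identityˡ; -1*i≡-i; *-cancelʳ-≡; i*j≡0⇒i≡0∨j≡0;
           i-j≡0⇒i≡j; +-injective; [+m]-[+n]≡m⊖n; ⊖-≥; ⊖-≤)
  open import Data.Integer.Tactic.RingSolver using (solve-∀)
  import Data.Nat as ℕ
  open import Data.Product.Properties using (≡-dec)
  open import Data.Sign using (Sign) renaming (opposite to flip)
  import Data.Sign.Properties as Sign
  open import Relation.Nullary using (Dec; ¬?)
  open import Relation.Nullary.Decidable using (_×-dec_; _⊎-dec_; _→-dec_; map′; toWitness)
  open import Relation.Unary using (Decidable)

  -- (s , σ , τ) is the leap (σ p , τ q), or (σ q , τ p) when s is true.
  Move : Set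
  Move = Bool × Sign × Sign

  opposite : Move → Move
  opposite (s , σ , τ) = s , flip σ , flip τ

  _≟ᴹ_ : (m m′ : Move) → Dec (m ≡ m′)
  _≟ᴹ_ = ≡-dec Bool._≟_ (≡-dec Sign._≟_ Sign._≟_)

  ±1 : Sign → ℤ
  ±1 Sign.+ = 1ℤ
  ±1 Sign.- = -1ℤ

  Form : Set
  Form = ℤ × ℤ

  eval : ℕ → ℕ → Form → ℤ
  eval p q (a , b) = a * + p + b * + q

  infixl 6 _⊕_
  _⊕_ : Form → Form → Form
  (a , b) ⊕ (c , d) = a + c , b + d

  form : Axis → Move → Form
  form horizontal (false , σ , _) = ±1 σ , 0ℤ
  form horizontal (true  , σ , _) = 0ℤ , ±1 σ
  form vertical   (false , _ , τ) = 0ℤ , ±1 τ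
  form vertical   (true  , _ , τ) = ±1 τ , 0ℤ

  form-⊕-opposite : ∀ a m → form a m ⊕ form a (opposite m) ≡ (0ℤ , 0ℤ)
  form-⊕-opposite horizontal (false , Sign.+ , _) = refl
  form-⊕-opposite horizontal (false , Sign.- , _) = refl
  form-⊕-opposite horizontal (true  , Sign.+ , _) = refl
  form-⊕-opposite horizontal (true  , Sign.- , _) = refl
  form-⊕-opposite vertical   (false , _ , Sign.+) = refl
  form-⊕-opposite vertical   (false , _ , Sign.-) = refl
  form-⊕-opposite vertical   (true  , _ , Sign.+) = refl
  form-⊕-opposite vertical   (true  , _ , Sign.-) = refl

  walk : Axis → Move → Move → Move → Move → Form
  walk a m₁ m₂ m₃ m₄ = form a m₁ ⊕ form a m₂ ⊕ form a m₃ ⊕ form a m₄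

  Admissible : ℤ → ℤ → Set
  Admissible a b = (a ≡ 0ℤ × b ≡ 0ℤ) ⊎ (a * b < 0ℤ × a + b ≢ 0ℤ)

  admissible? : ∀ a b → Dec (Admissible a b)
  admissible? a b = (a ≟ℤ 0ℤ ×-dec b ≟ℤ 0ℤ) ⊎-dec (a * b <? 0ℤ ×-dec ¬? (a + b ≟ℤ 0ℤ))

  Consistent : Form → Form → Set
  Consistent (a , b) (c , d) = Admissible a b × Admissible c d × a * d ≡ b * c

  consistent? : ∀ f g → Dec (Consistent f g)
  consistent? (a , b) (c , d) = admissible? a b ×-dec admissible? c d ×-dec a * d ≟ℤ b * c

  ∀-Bool? : ∀ {P : Bool → Set} → Decidable P → Dec (∀ b → P b)
  ∀-Bool? P? = map′ (λ (f , t) → λ { false → f ; true → t }) (λ h → h false , h true)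
    (P? false ×-dec P? true)

  ∀-Sign? : ∀ {P : Sign → Set} → Decidable P → Dec (∀ s → P s)
  ∀-Sign? P? = map′ (λ (m , p) → λ { Sign.- → m ; Sign.+ → p }) (λ h → h Sign.- , h Sign.+)
    (P? Sign.- ×-dec P? Sign.+)

  ∀-Move? : ∀ {P : Move → Set} → Decidable P → Dec (∀ m → P m)
  ∀-Move? P? = map′ (λ h (s , σ , τ) → h s σ τ) (λ h s σ τ → h (s , σ , τ))
    (∀-Bool? λ s → ∀-Sign? λ σ → ∀-Sign? λ τ → P? (s , σ , τ))

  -- Decided by evaluation over all 8⁴ quadruples of moves.
  consistent-walk-backtracks : ∀ m₁ m₂ m₃ m₄ →
    Consistent (walk horizontal m₁ m₂ m₃ m₄) (walk vertical m₁ m₂ m₃ m₄) →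
    m₂ ≡ opposite m₁ ⊎ m₃ ≡ opposite m₁ ⊎ m₄ ≡ opposite m₁
  consistent-walk-backtracks = toWitness
    {a? = ∀-Move? λ m₁ → ∀-Move? λ m₂ → ∀-Move? λ m₃ → ∀-Move? λ m₄ →
      consistent? (walk horizontal m₁ m₂ m₃ m₄) (walk vertical m₁ m₂ m₃ m₄)
        →-dec (m₂ ≟ᴹ opposite m₁ ⊎-dec m₃ ≟ᴹ opposite m₁ ⊎-dec m₄ ≟ᴹ opposite m₁)} _

  eval-⊕ : ∀ p q f g → eval p q (f ⊕ g) ≡ eval p q f + eval p q g
  eval-⊕ p q (a , b) (c , d) = distrib a b c d (+ p) (+ q)
    where
    distrib : ∀ a b c d P Q → (a + c) * P + (b + d) * Q ≡ (a * P + b * Q) + (c * P + d * Q)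
    distrib = solve-∀

  eval-opposite : ∀ p q a m → eval p q (form a m) + eval p q (form a (opposite m)) ≡ 0ℤ
  eval-opposite p q a m = begin
    eval p q (form a m) + eval p q (form a (opposite m))  ≡⟨ eval-⊕ p q (form a m) _ ⟨
    eval p q (form a m ⊕ form a (opposite m))             ≡⟨ cong (eval p q) (form-⊕-opposite a m) ⟩
    0ℤ                                                    ∎
    where open ≡-Reasoning

  eval≡0∧a+b≡0⇒a≡0∨p≡q : ∀ p q a b → eval p q (a , b) ≡ 0ℤ → a + b ≡ 0ℤ → a ≡ 0ℤ ⊎ p ≡ q
  eval≡0∧a+b≡0⇒a≡0∨p≡q p q a b e s =
    Sum.map₂ (λ d → +-injective (i-j≡0⇒i≡j (+ p) (+ q) d)) (i*j≡0⇒i≡0∨j≡0 a (begin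
      a * (+ p - + q)                   ≡⟨ factor a b (+ p) (+ q) ⟩
      eval p q (a , b) - (a + b) * + q  ≡⟨ cong₂ (λ x y → x - y * + q) e s ⟩
      0ℤ                                ∎))
    where
    open ≡-Reasoning
    factor : ∀ a b P Q → a * (P - Q) ≡ (a * P + b * Q) - (a + b) * Q
    factor = solve-∀

  eval≡0⇒admissible : ∀ {p q} .{{_ : NonZero p}} .{{_ : NonZero q}} → p ≢ q →
    ∀ a b → eval p q (a , b) ≡ 0ℤ → Admissible a b
  eval≡0⇒admissible {zero} {{()}}
  eval≡0⇒admissible {q = zero} {{_}} {{()}}
  eval≡0⇒admissible {suc _} {suc _} _ (+ zero) (+ zero) _ = inj₁ (refl , refl)
  eval≡0⇒admissible {suc _} {suc _} p≢q a@(+[1+ _ ]) b@(-[1+ _ ]) e =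
    inj₂ (-<+ , λ s → [ (λ ()) , p≢q ]′ (eval≡0∧a+b≡0⇒a≡0∨p≡q _ _ a b e s))
  eval≡0⇒admissible {suc _} {suc _} p≢q a@(-[1+ _ ]) b@(+[1+ _ ]) e =
    inj₂ (-<+ , λ s → [ (λ ()) , p≢q ]′ (eval≡0∧a+b≡0⇒a≡0∨p≡q _ _ a b e s))
  eval≡0⇒admissible {suc _} {suc _} _ (+ zero) +[1+ _ ] ()
  eval≡0⇒admissible {suc _} {suc _} _ (+ zero) -[1+ _ ] ()
  eval≡0⇒admissible {suc _} {suc _} _ +[1+ _ ] (+ zero) ()
  eval≡0⇒admissible {suc _} {suc _} _ +[1+ _ ] +[1+ _ ] ()
  eval≡0⇒admissible {suc _} {suc _} _ -[1+ _ ] (+ zero) ()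
  eval≡0⇒admissible {suc _} {suc _} _ -[1+ _ ] -[1+ _ ] ()

  eval≡0⇒ad≡bc : ∀ {p} q .{{_ : NonZero p}} a b c d →
    eval p q (a , b) ≡ 0ℤ → eval p q (c , d) ≡ 0ℤ → a * d ≡ b * c
  eval≡0⇒ad≡bc {p} q a b c d e₁ e₂ = *-cancelʳ-≡ (a * d) (b * c) (+ p) (begin
    a * d * + p
      ≡⟨ eliminate a b c d (+ p) (+ q) ⟩
    b * c * + p + (d * eval p q (a , b) - b * eval p q (c , d))
      ≡⟨ cong₂ (λ x y → b * c * + p + (d * x - b * y)) e₁ e₂ ⟩
    b * c * + p + (d * 0ℤ - b * 0ℤ)
      ≡⟨ cancel (b * c * + p) d b ⟩
    b * c * + p ∎)
    where
    open ≡-Reasoning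
    eliminate : ∀ a b c d P Q →
      a * d * P ≡ b * c * P + (d * (a * P + b * Q) - b * (c * P + d * Q))
    eliminate = solve-∀
    cancel : ∀ x d b → x + (d * 0ℤ - b * 0ℤ) ≡ x
    cancel = solve-∀

  eval≡0⇒consistent : ∀ {p q} .{{_ : NonZero p}} .{{_ : NonZero q}} → p ≢ q →
    ∀ f g → eval p q f ≡ 0ℤ → eval p q g ≡ 0ℤ → Consistent f g
  eval≡0⇒consistent {q = q} p≢q (a , b) (c , d) e₁ e₂ =
    eval≡0⇒admissible p≢q a b e₁ , eval≡0⇒admissible p≢q c d e₂ , eval≡0⇒ad≡bc q a b c d e₁ e₂

  Δ : ℕ → ℕ → ℤ
  Δ m n = + n - + m

  Δ≡±∣-∣ : ∀ m n {k} → ∣ m - n ∣ ≡ k → Σ Sign λ σ → Δ m n ≡ ±1 σ * + k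
  Δ≡±∣-∣ m n refl with ≤-total m n
  ... | inj₁ m≤n = Sign.+ , (begin
    + n - + m          ≡⟨ [+m]-[+n]≡m⊖n n m ⟩
    n ⊖ m              ≡⟨ ⊖-≥ m≤n ⟩
    + (n ∸ m)          ≡⟨ cong +_ (m≤n⇒∣m-n∣≡n∸m m≤n) ⟨
    + ∣ m - n ∣        ≡⟨ *-identityˡ _ ⟨
    1ℤ * + ∣ m - n ∣   ∎)
    where open ≡-Reasoning
  ... | inj₂ n≤m = Sign.- , (begin
    + n - + m          ≡⟨ [+m]-[+n]≡m⊖n n m ⟩
    n ⊖ m              ≡⟨ ⊖-≤ n≤m ⟩
    - + (m ∸ n)        ≡⟨ cong (λ k → - + k) (m≤n⇒∣n-m∣≡n∸m n≤m) ⟨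
    - + ∣ m - n ∣      ≡⟨ -1*i≡-i _ ⟨
    -1ℤ * + ∣ m - n ∣  ∎)
    where open ≡-Reasoning

  Step : ∀ {n} → ℕ → ℕ → Vertex n → Move → Vertex n → Set
  Step p q u m v = ∀ a → Δ (coord a u) (coord a v) ≡ eval p q (form a m)

  leaper-step : ∀ {p q n} {u v : Vertex n} → LeaperAdj p q u v → Σ Move (λ m → Step p q u m v)
  leaper-step {u = u} {v} (inj₁ (dx≡p , dy≡q))
    with σ , δx ← Δ≡±∣-∣ (coord horizontal u) (coord horizontal v) dx≡p
       | τ , δy ← Δ≡±∣-∣ (coord vertical u) (coord vertical v) dy≡q
       = (false , σ , τ) , λ where
           horizontal → trans δx (sym (+-identityʳ _))
           vertical   → trans δy (sym (+-identityˡ _))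
  leaper-step {u = u} {v} (inj₂ (dx≡q , dy≡p))
    with σ , δx ← Δ≡±∣-∣ (coord horizontal u) (coord horizontal v) dx≡q
       | τ , δy ← Δ≡±∣-∣ (coord vertical u) (coord vertical v) dy≡p
       = (true , σ , τ) , λ where
           horizontal → trans δx (sym (+-identityˡ _))
           vertical   → trans δy (sym (+-identityʳ _))

  Δ-cycle : ∀ c₀ c₁ c₂ c₃ → Δ c₀ c₁ + Δ c₁ c₂ + Δ c₂ c₃ + Δ c₃ c₀ ≡ 0ℤ
  Δ-cycle c₀ c₁ c₂ c₃ = telescope (+ c₀) (+ c₁) (+ c₂) (+ c₃)
    where
    telescope : ∀ A B C D → (B - A) + (C - B) + (D - C) + (A - D) ≡ 0ℤ
    telescope = solve-∀

  Δ+Δ≡0⇒+≡+ : ∀ a b c d → Δ a b + Δ c d ≡ 0ℤ → b ℕ.+ d ≡ a ℕ.+ c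
  Δ+Δ≡0⇒+≡+ a b c d e =
    +-injective (i-j≡0⇒i≡j _ _ (trans (regroup (+ a) (+ b) (+ c) (+ d)) e))
    where
    regroup : ∀ A B C D → (B + D) - (A + C) ≡ (B - A) + (D - C)
    regroup = solve-∀

  closed-walk : ∀ {p q n} {u₀ u₁ u₂ u₃ : Vertex n} {m₁ m₂ m₃ m₄} →
    Step p q u₀ m₁ u₁ → Step p q u₁ m₂ u₂ → Step p q u₂ m₃ u₃ → Step p q u₃ m₄ u₀ →
    ∀ a → eval p q (walk a m₁ m₂ m₃ m₄) ≡ 0ℤ
  closed-walk {p} {q} {u₀ = u₀} {u₁} {u₂} {u₃} {m₁} {m₂} {m₃} {m₄} δ₁ δ₂ δ₃ δ₄ a = begin
    eval p q (f₁ ⊕ f₂ ⊕ f₃ ⊕ f₄)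
      ≡⟨ trans (eval-⊕ p q (f₁ ⊕ f₂ ⊕ f₃) f₄)
           (cong (_+ _) (trans (eval-⊕ p q (f₁ ⊕ f₂) f₃) (cong (_+ _) (eval-⊕ p q f₁ f₂)))) ⟩
    eval p q f₁ + eval p q f₂ + eval p q f₃ + eval p q f₄
      ≡⟨ cong₂ _+_ (cong₂ _+_ (cong₂ _+_ (δ₁ a) (δ₂ a)) (δ₃ a)) (δ₄ a) ⟨
    Δ (c u₀) (c u₁) + Δ (c u₁) (c u₂) + Δ (c u₂) (c u₃) + Δ (c u₃) (c u₀)
      ≡⟨ Δ-cycle (c u₀) (c u₁) (c u₂) (c u₃) ⟩
    0ℤ ∎
    where
    open ≡-Reasoning
    c : Vertex _ → ℕ
    c = coord a
    f₁ f₂ f₃ f₄ : Form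
    f₁ = form a m₁
    f₂ = form a m₂
    f₃ = form a m₃
    f₄ = form a m₄

  opposite-steps : ∀ {p q n} {u v w z : Vertex n} {m} →
    Step p q u m v → Step p q w (opposite m) z →
    ∀ a → coord a v ℕ.+ coord a z ≡ coord a u ℕ.+ coord a w
  opposite-steps {p} {q} {u = u} {v} {w} {z} {m} δ δ′ a =
    Δ+Δ≡0⇒+≡+ (coord a u) (coord a v) (coord a w) (coord a z)
      (trans (cong₂ _+_ (δ a) (δ′ a)) (eval-opposite p q a m))

  backtracking-square-parallelogram : ∀ {p q n} {u₀ u₁ u₂ u₃ : Vertex n} {m₁ m₂ m₃ m₄} →
    Step p q u₀ m₁ u₁ → Step p q u₁ m₂ u₂ → Step p q u₂ m₃ u₃ → Step p q u₃ m₄ u₀ →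
    u₂ ≢ u₀ → u₃ ≢ u₁ → m₂ ≡ opposite m₁ ⊎ m₃ ≡ opposite m₁ ⊎ m₄ ≡ opposite m₁ →
    ∀ a → coord a u₁ ℕ.+ coord a u₃ ≡ coord a u₀ ℕ.+ coord a u₂
  backtracking-square-parallelogram {u₀ = u₀} {u₁} δ₁ δ₂ _ _ u₂≢u₀ _ (inj₁ refl) =
    ⊥-elim (u₂≢u₀ (vertex-≡ λ a → +-cancelˡ-≡ (coord a u₁) _ _
      (trans (opposite-steps δ₁ δ₂ a) (+-comm (coord a u₀) (coord a u₁)))))
  backtracking-square-parallelogram δ₁ _ δ₃ _ _ _ (inj₂ (inj₁ refl)) = opposite-steps δ₁ δ₃
  backtracking-square-parallelogram {u₀ = u₀} {u₃ = u₃} δ₁ _ _ δ₄ _ u₃≢u₁ (inj₂ (inj₂ refl)) =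
    ⊥-elim (u₃≢u₁ (vertex-≡ λ a → sym (+-cancelʳ-≡ (coord a u₀) _ _
      (trans (opposite-steps δ₁ δ₄ a) (+-comm (coord a u₀) (coord a u₃))))))

  leaper-square-parallelogram : ∀ {p q n} .{{_ : NonZero p}} .{{_ : NonZero q}} → p ≢ q →
    {u₀ u₁ u₂ u₃ : Vertex n} →
    LeaperAdj p q u₀ u₁ → LeaperAdj p q u₁ u₂ → LeaperAdj p q u₂ u₃ → LeaperAdj p q u₃ u₀ →
    u₂ ≢ u₀ → u₃ ≢ u₁ → ∀ a → coord a u₁ ℕ.+ coord a u₃ ≡ coord a u₀ ℕ.+ coord a u₂
  leaper-square-parallelogram p≢q e₀₁ e₁₂ e₂₃ e₃₀ u₂≢u₀ u₃≢u₁
    with _ , δ₁ ← leaper-step e₀₁ | _ , δ₂ ← leaper-step e₁₂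
       | _ , δ₃ ← leaper-step e₂₃ | _ , δ₄ ← leaper-step e₃₀
       = backtracking-square-parallelogram δ₁ δ₂ δ₃ δ₄ u₂≢u₀ u₃≢u₁
           (consistent-walk-backtracks _ _ _ _ (eval≡0⇒consistent p≢q _ _
             (closed-walk δ₁ δ₂ δ₃ δ₄ horizontal) (closed-walk δ₁ δ₂ δ₃ δ₄ vertical)))

open LeaperCycles using (leaper-square-parallelogram)
open import Data.Nat using (_+_)
open import Data.Nat.Tactic.RingSolver using (solve-∀)

module Separable (z : ℕ → ℕ → ℕ) (m : ℕ)
  (square : ∀ i j → suc i ≤ m → suc j ≤ m →
            z (suc i) j + z i (suc j) ≡ z i j + z (suc i) (suc j)) where

  columns-parallel : ∀ i j → i ≤ m → suc j ≤ m → z i (suc j) + z 0 j ≡ z i j + z 0 (suc j)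
  columns-parallel zero    j _   _   = +-comm (z 0 (suc j)) (z 0 j)
  columns-parallel (suc i) j i<m j<m = +-cancelʳ-≡ (z i j + z i (suc j)) _ _ (begin
    z (suc i) (suc j) + z 0 j + (z i j + z i (suc j))
      ≡⟨ regroup₁ (z (suc i) (suc j)) (z 0 j) (z i j) (z i (suc j)) ⟩
    (z i j + z (suc i) (suc j)) + (z i (suc j) + z 0 j)
      ≡⟨ cong₂ _+_ (sym (square i j i<m j<m)) (columns-parallel i j (≤-trans (n≤1+n i) i<m) j<m) ⟩
    (z (suc i) j + z i (suc j)) + (z i j + z 0 (suc j))
      ≡⟨ regroup₂ (z (suc i) j) (z i (suc j)) (z i j) (z 0 (suc j)) ⟩
    z (suc i) j + z 0 (suc j) + (z i j + z i (suc j)) ∎)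
    where
    open ≡-Reasoning
    regroup₁ : ∀ a b c d → a + b + (c + d) ≡ (c + a) + (d + b)
    regroup₁ = solve-∀
    regroup₂ : ∀ a b c d → (a + b) + (c + d) ≡ a + d + (c + b)
    regroup₂ = solve-∀

  separable : ∀ i j → i ≤ m → j ≤ m → z i j + z 0 0 ≡ z i 0 + z 0 j
  separable i zero    _   _   = refl
  separable i (suc j) i≤m j<m = +-cancelʳ-≡ (z 0 j + z i j) _ _ (begin
    z i (suc j) + z 0 0 + (z 0 j + z i j)
      ≡⟨ regroup₁ (z i (suc j)) (z 0 0) (z 0 j) (z i j) ⟩
    (z i (suc j) + z 0 j) + (z i j + z 0 0)
      ≡⟨ cong₂ _+_ (columns-parallel i j i≤m j<m) (separable i j i≤m (≤-trans (n≤1+n j) j<m)) ⟩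
    (z i j + z 0 (suc j)) + (z i 0 + z 0 j)
      ≡⟨ regroup₂ (z i j) (z 0 (suc j)) (z i 0) (z 0 j) ⟩
    z i 0 + z 0 (suc j) + (z 0 j + z i j) ∎)
    where
    open ≡-Reasoning
    regroup₁ : ∀ a b c d → a + b + (c + d) ≡ (a + c) + (d + b)
    regroup₁ = solve-∀
    regroup₂ : ∀ a b c d → (a + b) + (c + d) ≡ c + b + (d + a)
    regroup₂ = solve-∀

  separable-mono : ∀ {i i′ j} → i ≤ m → i′ ≤ m → j ≤ m → z i j ≤ z i′ j → z i 0 ≤ z i′ 0
  separable-mono {i} {i′} {j} i≤m i′≤m j≤m le = +-cancelʳ-≤ (z 0 j) _ _
    (subst₂ _≤_ (separable i j i≤m j≤m) (separable i′ j i′≤m j≤m) (+-monoˡ-≤ (z 0 0) le))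

∣n-1+n∣≡1 : ∀ n → ∣ n - suc n ∣ ≡ 1
∣n-1+n∣≡1 n = trans (m≤n⇒∣m-n∣≡n∸m (n≤1+n n)) (m+n∸n≡m 1 n)

argmin≢argmax : ∀ {m} (r : ℕ → ℕ) {i₁ i₂} → 1 ≤ m →
  (∀ {i} → i ≤ m → r i₁ ≤ r i) → (∀ {i} → i ≤ m → r i ≤ r i₂) → r 0 ≢ r 1 → i₁ ≢ i₂
argmin≢argmax r 1≤m min max r0≢r1 refl =
  r0≢r1 (trans (≤-antisym (max z≤n) (min z≤n)) (≤-antisym (min 1≤m) (max 1≤m)))

Extremal : ℕ → ℕ → Set
Extremal m c = c ≡ 0 ⊎ c ≡ m

extremal⇒≤ : ∀ {m c} → Extremal m c → c ≤ m
extremal⇒≤ (inj₁ refl) = z≤n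
extremal⇒≤ (inj₂ refl) = ≤-refl

∣-∣-injective-at-extremal : ∀ {m c a b} → Extremal m c → a ≤ m → b ≤ m →
  ∣ c - a ∣ ≡ ∣ c - b ∣ → a ≡ b
∣-∣-injective-at-extremal (inj₁ refl) _ _ e = e
∣-∣-injective-at-extremal {m} {a = a} {b} (inj₂ refl) a≤m b≤m e = begin
  a            ≡⟨ m∸[m∸n]≡n a≤m ⟨
  m ∸ (m ∸ a)  ≡⟨ cong (m ∸_) (trans (sym (m≤n⇒∣n-m∣≡n∸m a≤m)) (trans e (m≤n⇒∣n-m∣≡n∸m b≤m))) ⟩
  m ∸ (m ∸ b)  ≡⟨ m∸[m∸n]≡n b≤m ⟩
  b            ∎
  where open ≡-Reasoning

pigeonhole-⊎ : ∀ {A : Set} {P Q : A → Set} →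
  (∀ {x y} → P x → P y → x ≡ y) → (∀ {x y} → Q x → Q y → x ≡ y) →
  ∀ {x y z} → P x ⊎ Q x → P y ⊎ Q y → P z ⊎ Q z → x ≡ y ⊎ x ≡ z ⊎ y ≡ z
pigeonhole-⊎ P-unique _ (inj₁ x) (inj₁ y) _        = inj₁ (P-unique x y)
pigeonhole-⊎ _ Q-unique (inj₂ x) (inj₂ y) _        = inj₁ (Q-unique x y)
pigeonhole-⊎ P-unique _ (inj₁ x) (inj₂ _) (inj₁ z) = inj₂ (inj₁ (P-unique x z))
pigeonhole-⊎ _ Q-unique (inj₂ x) (inj₁ _) (inj₂ z) = inj₂ (inj₁ (Q-unique x z))
pigeonhole-⊎ _ Q-unique (inj₁ _) (inj₂ y) (inj₂ z) = inj₂ (inj₂ (Q-unique y z))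
pigeonhole-⊎ P-unique _ (inj₂ _) (inj₁ y) (inj₁ z) = inj₂ (inj₂ (P-unique y z))

extremal-pigeonhole : ∀ {m i₁ i₂ i₃} → Extremal m i₁ → Extremal m i₂ → Extremal m i₃ →
  i₁ ≡ i₂ ⊎ i₁ ≡ i₃ ⊎ i₂ ≡ i₃
extremal-pigeonhole = pigeonhole-⊎ (λ x y → trans x (sym y)) (λ x y → trans x (sym y))

module _ {m : ℕ} where

  Corner : Vertex (suc m) → Set
  Corner v = ∀ a → Extremal m (coord a v)

  corner-offsets-injective : ∀ {Z w w′ : Vertex (suc m)} → Corner Z →
    dx Z w ≡ dx Z w′ → dy Z w ≡ dy Z w′ → w ≡ w′
  corner-offsets-injective {Z} {w} {w′} corner ex ey = vertex-≡ λ where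
    horizontal →
      ∣-∣-injective-at-extremal (corner horizontal) (coord≤ horizontal w) (coord≤ horizontal w′) ex
    vertical →
      ∣-∣-injective-at-extremal (corner vertical) (coord≤ vertical w) (coord≤ vertical w′) ey

  corner-leaper-degree≤2 : ∀ {p q} {Z w₁ w₂ w₃ : Vertex (suc m)} → Corner Z →
    LeaperAdj p q Z w₁ → LeaperAdj p q Z w₂ → LeaperAdj p q Z w₃ →
    w₁ ≡ w₂ ⊎ w₁ ≡ w₃ ⊎ w₂ ≡ w₃
  corner-leaper-degree≤2 {Z = Z} corner = pigeonhole-⊎ same-offsets same-offsets
    where
    same-offsets : ∀ {a b w w′} → dx Z w ≡ a × dy Z w ≡ b → dx Z w′ ≡ a × dy Z w′ ≡ b → w ≡ w′
    same-offsets (ex , ey) (ex′ , ey′) =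
      corner-offsets-injective corner (trans ex (sym ex′)) (trans ey (sym ey′))

  -- Grid points are addressed by natural numbers; indices above m are clamped to m.
  clamp : ℕ → Fin (suc m)
  clamp i = fromℕ< (s≤s (m⊓n≤n i m))

  toℕ-clamp : ∀ {i} → i ≤ m → toℕ (clamp i) ≡ i
  toℕ-clamp {i} i≤m = trans (toℕ-fromℕ< (s≤s (m⊓n≤n i m))) (m≤n⇒m⊓n≡m i≤m)

  point : ℕ → ℕ → Vertex (suc m)
  point i j = clamp i , clamp j

  point-coord : ∀ (v : Vertex (suc m)) → point (coord horizontal v) (coord vertical v) ≡ v
  point-coord v = vertex-≡ λ where
    horizontal → toℕ-clamp (coord≤ horizontal v)
    vertical   → toℕ-clamp (coord≤ vertical v)

  corner-point : ∀ {i j} → Extremal m i → Extremal m j → Corner (point i j)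
  corner-point ei _  horizontal = subst (Extremal m) (sym (toℕ-clamp (extremal⇒≤ ei))) ei
  corner-point _  ej vertical   = subst (Extremal m) (sym (toℕ-clamp (extremal⇒≤ ej))) ej

  grid-step-right : ∀ i j → suc i ≤ m → GridAdj (point i j) (point (suc i) j)
  grid-step-right i j i<m = inj₁
    ( trans (cong₂ ∣_-_∣ (toℕ-clamp (≤-trans (n≤1+n i) i<m)) (toℕ-clamp i<m)) (∣n-1+n∣≡1 i)
    , ∣n-n∣≡0 (toℕ (clamp j)) )

  grid-step-up : ∀ i j → suc j ≤ m → GridAdj (point i j) (point i (suc j))
  grid-step-up i j j<m = inj₂
    ( ∣n-n∣≡0 (toℕ (clamp i))
    , trans (cong₂ ∣_-_∣ (toℕ-clamp (≤-trans (n≤1+n j) j<m)) (toℕ-clamp j<m)) (∣n-1+n∣≡1 j) )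

  grid-step-left : ∀ i j → suc i ≤ m → GridAdj (point (suc i) j) (point i j)
  grid-step-left i j i<m = GridAdj-sym (point i j) (point (suc i) j) (grid-step-right i j i<m)

  grid-step-down : ∀ i j → suc j ≤ m → GridAdj (point i (suc j)) (point i j)
  grid-step-down i j j<m = GridAdj-sym (point i j) (point i (suc j)) (grid-step-up i j j<m)

  vertical-neighbour : 1 ≤ m → ∀ i j → j ≤ m →
    ∃ λ j′ → j′ ≤ m × GridAdj (point i j) (point i j′)
  vertical-neighbour _ i j _ with suc j ≤? m
  ... | yes j<m = suc j , j<m , grid-step-up i j j<m
  vertical-neighbour 1≤m _ zero    _   | no 1≰m = ⊥-elim (1≰m 1≤m)
  vertical-neighbour _   i (suc j) j<m | no _   = j , ≤-trans (n≤1+n j) j<m , grid-step-down i j j<m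

module Embedding {p q m : ℕ} .{{_ : NonZero p}} .{{_ : NonZero q}} (p≢q : p ≢ q) (1≤m : 1 ≤ m)
  (f : Vertex (suc m) → Vertex (suc m)) (f-injective : Injective _≡_ _≡_ f)
  (f-hom : ∀ u v → GridAdj u v → LeaperAdj p q (f u) (f v)) where

  z : Axis → ℕ → ℕ → ℕ
  z a i j = coord a (f (point i j))

  surjective : ∀ v → ∃ λ u → f u ≡ v
  surjective = ↔Fin-injective⇒surjective *↔× f f-injective

  different-rows : ∀ {i j i′ j′} → i ≤ m → i′ ≤ m → i ≢ i′ → f (point i j) ≢ f (point i′ j′)
  different-rows {i} {j} {i′} {j′} i≤m i′≤m i≢i′ e = i≢i′ (begin
    i                               ≡⟨ toℕ-clamp i≤m ⟨
    coord horizontal (point i j)    ≡⟨ cong (coord horizontal) (f-injective e) ⟩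
    coord horizontal (point i′ j′)  ≡⟨ toℕ-clamp i′≤m ⟩
    i′                              ∎)
    where open ≡-Reasoning

  square-parallelogram : ∀ a i j → suc i ≤ m → suc j ≤ m →
    z a (suc i) j + z a i (suc j) ≡ z a i j + z a (suc i) (suc j)
  square-parallelogram a i j i<m j<m = leaper-square-parallelogram p≢q
    (f-hom (point i j) (point (suc i) j) (grid-step-right i j i<m))
    (f-hom (point (suc i) j) (point (suc i) (suc j)) (grid-step-up (suc i) j j<m))
    (f-hom (point (suc i) (suc j)) (point i (suc j)) (grid-step-left i (suc j) i<m))
    (f-hom (point i (suc j)) (point i j) (grid-step-down i j j<m))
    (different-rows i<m i≤m 1+n≢n) (different-rows i≤m i<m (≢-sym 1+n≢n)) a
    where
    i≤m : i ≤ m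
    i≤m = ≤-trans (n≤1+n i) i<m

  row-minimal : ∀ a {i₀ j₀} → i₀ ≤ m → j₀ ≤ m → z a i₀ j₀ ≡ 0 →
    ∀ {i} → i ≤ m → z a i₀ 0 ≤ z a i 0
  row-minimal a {i₀} {j₀} i₀≤m j₀≤m z≡0 {i} i≤m =
    separable-mono i₀≤m i≤m j₀≤m (subst (_≤ z a i j₀) (sym z≡0) z≤n)
    where open Separable (z a) m (square-parallelogram a)

  row-maximal : ∀ a {i₀ j₀} → i₀ ≤ m → j₀ ≤ m → z a i₀ j₀ ≡ m →
    ∀ {i} → i ≤ m → z a i 0 ≤ z a i₀ 0
  row-maximal a {i₀} {j₀} i₀≤m j₀≤m z≡m {i} i≤m =
    separable-mono i≤m i₀≤m j₀≤m (subst (z a i j₀ ≤_) (sym z≡m) (coord≤ a (f (point i j₀))))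
    where open Separable (z a) m (square-parallelogram a)

  first-column-varies : ∀ a → z a 0 0 ≢ z a 1 0
  first-column-varies = leaperAdj⇒coord≢ (f-hom (point 0 0) (point 1 0) (grid-step-right 0 0 1≤m))

  middle-row-not-corner : ∀ {i j} → suc (suc i) ≤ m → j ≤ m → ¬ Corner (f (point (suc i) j))
  middle-row-not-corner {i} {j} i+2≤m j≤m corner =
    let j′ , _ , up = vertical-neighbour 1≤m (suc i) j j≤m in
    [ different-rows i≤m i+2≤m i≢2+i
    , [ different-rows i≤m i+1≤m (≢-sym 1+n≢n) , different-rows i+2≤m i+1≤m 1+n≢n ]′ ]′
      (corner-leaper-degree≤2 corner
        (f-hom _ (point i j) (grid-step-left i j i+1≤m))
        (f-hom _ (point (suc (suc i)) j) (grid-step-right (suc i) j i+2≤m))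
        (f-hom _ (point (suc i) j′) up))
    where
    i+1≤m : suc i ≤ m
    i+1≤m = ≤-trans (n≤1+n (suc i)) i+2≤m
    i≤m : i ≤ m
    i≤m = ≤-trans (n≤1+n i) i+1≤m
    i≢2+i : i ≢ suc (suc i)
    i≢2+i = <⇒≢ (<-trans (n<1+n i) (n<1+n (suc i)))

  boundary-row : ∀ {i j} → i ≤ m → j ≤ m → Corner (f (point i j)) → Extremal m i
  boundary-row {zero} _ _ _ = inj₁ refl
  boundary-row {suc i} i<m j≤m corner with suc i ≟ℕ m
  ... | yes i+1≡m = inj₂ i+1≡m
  ... | no  i+1≢m = ⊥-elim (middle-row-not-corner (≤∧≢⇒< i<m i+1≢m) j≤m corner)

  record CornerPreimage (v : Vertex (suc m)) : Set where
    field
      row      : ℕ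
      boundary : Extremal m row
      minimal  : ∀ a → coord a v ≡ 0 → ∀ {i} → i ≤ m → z a row 0 ≤ z a i 0
      maximal  : ∀ a → coord a v ≡ m → ∀ {i} → i ≤ m → z a i 0 ≤ z a row 0

  corner-preimage : ∀ {v} → Corner v → CornerPreimage v
  corner-preimage {v} corner = record
    { row      = i
    ; boundary = boundary-row i≤m j≤m (subst Corner (sym f[i,j]≡v) corner)
    ; minimal  = λ a c≡0 → row-minimal a i≤m j≤m (trans (cong (coord a) f[i,j]≡v) c≡0)
    ; maximal  = λ a c≡m → row-maximal a i≤m j≤m (trans (cong (coord a) f[i,j]≡v) c≡m)
    }
    where
    u : Vertex (suc m)
    u = proj₁ (surjective v)
    i j : ℕ
    i = coord horizontal u
    j = coord vertical u
    i≤m : i ≤ m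
    i≤m = coord≤ horizontal u
    j≤m : j ≤ m
    j≤m = coord≤ vertical u
    f[i,j]≡v : f (point i j) ≡ v
    f[i,j]≡v = trans (cong f (point-coord u)) (proj₂ (surjective v))

  open CornerPreimage public

  min-row≢max-row : ∀ a {v w} (c : CornerPreimage v) (c′ : CornerPreimage w) →
    coord a v ≡ 0 → coord a w ≡ m → row c ≢ row c′
  min-row≢max-row a c c′ v≡0 w≡m =
    argmin≢argmax (λ i → z a i 0) 1≤m (minimal c a v≡0) (maximal c′ a w≡m) (first-column-varies a)

proposition3 : (p q n : ℕ) → 1 ≤ p → 1 ≤ q → p ≢ q → 2 ≤ n →
    ¬ Embeds (GridAdj {n}) (LeaperAdj p q {n})
proposition3 (suc p) (suc q) (suc m) _ _ p≢q (s≤s 1≤m) (f , f-injective , f-hom) =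
  [ min-row≢max-row horizontal c₀₀ cₘ₀ refl (toℕ-clamp ≤-refl)
  , [ min-row≢max-row vertical c₀₀ c₀ₘ refl (toℕ-clamp ≤-refl)
    , ≢-sym (min-row≢max-row horizontal c₀ₘ cₘ₀ refl (toℕ-clamp ≤-refl)) ]′ ]′
    (extremal-pigeonhole (boundary c₀₀) (boundary cₘ₀) (boundary c₀ₘ))
  where
  open Embedding p≢q 1≤m f f-injective f-hom
  c₀₀ : CornerPreimage (point 0 0)
  c₀₀ = corner-preimage (corner-point (inj₁ refl) (inj₁ refl))
  cₘ₀ : CornerPreimage (point m 0)
  cₘ₀ = corner-preimage (corner-point (inj₂ refl) (inj₁ refl))
  c₀ₘ : CornerPreimage (point 0 m)
  c₀ₘ = corner-preimage (corner-point (inj₁ refl) (inj₂ refl))
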